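{- For finite simple graphs $G$ and $H$, \[\sigma(G\odot H)=\sigma(K_1\vee H)=\begin{cases}\sigma(H) & \text{if } H \text{ has at least one edge},\\ |V_H| & \text{if } H \text{ has no edges}.\end{cases}\]
   Context: The corona $G\odot H$ is obtained by taking, for each vertex $v$ of $G$, a copy $H_v$ of $H$, and adding edges from $v$ to every vertex of $H_v$. $K_1\vee H$ is $H$ together with one new vertex adjacent to all vertices of $H$. $\Delta$ is maximum degree, $\alpha$ independence number; for a graph $X=(V,E)$ with at least one edge, $\sigma(X)=\min\{\Delta(X[S]): S\subseteq V,\ |S|>\alpha(X)\}$ where $X[S]$ is the induced subgraph. -}

module Defs where

open import Data.Bool using (Bool; true; false; _∧_; _∨_; not; if_then_else_)
open import Data.Nat using (ℕ; zero; suc; _*_; _⊔_; _⊓_; _<ᵇ_)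
open import Data.Fin using (Fin; zero; suc; remQuot; _≟_)
open import Data.Fin.Subset using (Subset; ∣_∣)
open import Data.Vec using (Vec; []; _∷_; lookup)
open import Data.List using (List; []; _∷_; [_]; _++_; map; foldr; filter; allFin)
open import Data.Product using (_×_; _,_; ∃₂)
open import Relation.Nullary.Decidable using (⌊_⌋)
open import Relation.Binary.PropositionalEquality using (_≡_)

Adj : ℕ → Set
Adj n = Fin n → Fin n → Bool

record SimpleGraph (n : ℕ) : Set where
  field
    adj    : Adj n
    sym    : ∀ u v → adj u v ≡ adj v u
    irrefl : ∀ v → adj v v ≡ false
open SimpleGraph public

HasEdge : ∀ {n} → Adj n → Set
HasEdge {n} A = ∃₂ λ (u v : Fin n) → A u v ≡ true

-- K₁ ∨ H : vertex zero is the new vertex, suc k is vertex k of H.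
join1 : ∀ {m} → Adj m → Adj (suc m)
join1 A zero    zero    = false
join1 A zero    (suc _) = true
join1 A (suc _) zero    = true
join1 A (suc k) (suc l) = A k l

-- Corona G ⊙ H on Fin (n * suc m): vertex (i , j) (via remQuot) with
-- j = zero the vertex i of G, j = suc k the vertex k of the copy H_i.
-- Adjacency inside the block {i} × Fin (suc m) is exactly that of K₁ ∨ H.
coronaPair : ∀ {n m} → Adj n → Adj m → (Fin n × Fin (suc m)) → (Fin n × Fin (suc m)) → Bool
coronaPair G H (i , zero)  (i' , zero)  = G i i'
coronaPair G H (i , j)     (i' , j')    = ⌊ i ≟ i' ⌋ ∧ join1 H j j'

corona : ∀ {n m} → Adj n → Adj m → Adj (n * suc m)
corona {n} {m} G H u v = coronaPair G H (remQuot (suc m) u) (remQuot (suc m) v)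

allSubsets : (n : ℕ) → List (Subset n)
allSubsets zero    = [ [] ]
allSubsets (suc n) = map (true ∷_) (allSubsets n) ++ map (false ∷_) (allSubsets n)

maxList : List ℕ → ℕ
maxList = foldr _⊔_ 0

-- minimum of a list (value on the empty list is irrelevant: 0)
minList : List ℕ → ℕ
minList []       = 0
minList (x ∷ xs) = foldr _⊓_ x xs

-- degree of v in the induced subgraph X[S] (v assumed in S)
degIn : ∀ {n} → Adj n → Subset n → Fin n → ℕ
degIn {n} A S v = Data.List.length (filter (λ w → Data.Bool._≟_ (lookup S w ∧ A v w) true) (allFin n))
  where import Data.List ; import Data.Bool

-- Δ(X[S])  (0 for the empty set)
maxDegInduced : ∀ {n} → Adj n → Subset n → ℕ
maxDegInduced {n} A S = maxList (map (λ v → if lookup S v then degIn A S v else 0) (allFin n))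

allB : ∀ {A : Set} → (A → Bool) → List A → Bool
allB p = foldr (λ x b → p x ∧ b) true

isIndependent : ∀ {n} → Adj n → Subset n → Bool
isIndependent {n} A S =
  allB (λ v → allB (λ w → not (lookup S v ∧ lookup S w ∧ A v w)) (allFin n)) (allFin n)

indepNumber : ∀ {n} → Adj n → ℕ
indepNumber {n} A = maxList (map ∣_∣ (filter (λ S → Data.Bool._≟_ (isIndependent A S) true) (allSubsets n)))
  where import Data.Bool

-- σ(X) = min { Δ(X[S]) : S ⊆ V, |S| > α(X) }  (meaningful when X has an edge)
sigma : ∀ {n} → Adj n → ℕ
sigma {n} A = minList (map (maxDegInduced A)
  (filter (λ S → Data.Bool._≟_ (indepNumber A <ᵇ ∣ S ∣) true) (allSubsets n)))
  where import Data.Bool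

-- σ is compared through admissible vertex sets, those with more than α vertices:
-- if every admissible set of X is matched by an admissible set of Y of no larger
-- induced maximum degree, and conversely, then σ(X) = σ(Y).
--
-- For J = K₁ ∨ H with H nonempty, α(J) = α(H). An admissible set of J avoiding the
-- apex is admissible in H; one containing the apex gives the apex degree at least
-- α(H), and when H has an edge a maximum independent set of H plus one further
-- vertex is admissible in H with maximum degree at most α(H). When H is edgeless,
-- every admissible set of J contains the apex, whose degree is then at least |V_H|,
-- and the whole vertex set attains this.
--
-- G ⊙ H is one copy of J per vertex of G, the apexes being joined as in G, and
-- α(G ⊙ H) = |V_G| α(J). By pigeonhole an admissible set of G ⊙ H has more than
-- α(J) vertices in some copy. Conversely, an admissible set of J placed in one copy
-- and completed by an apex-free maximum independent set of J in every other copy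
-- is admissible in G ⊙ H with the same maximum degree.
module Submission where

open import Defs hiding (sym)
open import Function using (_∘_; id)
open import Function.Bundles using (Equivalence)
open import Data.Bool using (Bool; true; false; _∧_; _∨_; not; if_then_else_)
import Data.Bool as Bool
open import Data.Bool.Properties
  using (¬-not; not-involutive; ∨-zeroʳ; ∨-identityʳ; ∧-zeroʳ; ∧-identityʳ; ∧-conicalˡ; ∧-conicalʳ; T-≡)
open import Data.Nat using (ℕ; zero; suc; _+_; _*_; _⊔_; _<ᵇ_; _≤_; _<_; z≤n; s≤s)
open import Data.Nat.Properties hiding (_≟_)
open import Data.Fin using (Fin; zero; suc; combine; remQuot; _↑ˡ_; _↑ʳ_; _≟_)
open import Data.Fin.Properties using (any?; ¬∀⟶∃¬; remQuot-combine; combine-remQuot)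
open import Data.Fin.Subset using (Subset; ∣_∣)
open import Data.Vec using ([]; _∷_; lookup; tabulate)
open import Data.Vec.Properties using (lookup∘tabulate; tabulate∘lookup)
open import Data.Vec.Functional using () renaming (_∷_ to _∷ᶠ_)
import Data.List as List
open import Data.List using (List; []; _∷_; map; filter; length; allFin)
open import Data.List.Membership.Propositional using (_∈_)
open import Data.List.Membership.Propositional.Properties
  using (foldr-selective; ∈-filter⁺; ∈-filter⁻; ∈-map⁺; ∈-map⁻; ∈-++⁺ˡ; ∈-++⁺ʳ; ∈-allFin)
open import Data.List.Properties using (foldr-forcesᵇ; foldr-preservesᵇ; foldr-preservesʳ)
open import Data.List.Relation.Unary.All as All using (All)
open import Data.List.Relation.Unary.Any using (here; there)
open import Data.Product using (_×_; _,_; ∃; proj₁; proj₂; uncurry; map₂)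
open import Data.Sum using (_⊎_; inj₁; inj₂)
open import Algebra.Properties.Monoid.Sum +-0-monoid using (sum; sum-cong-≗; sum-replicate-zero)
open import Relation.Nullary using (¬_; yes; no; does; contradiction)
open import Relation.Nullary.Decidable using (⌊_⌋; isYes≗does; dec-true; dec-false)
open import Relation.Binary.PropositionalEquality
  using (_≡_; _≢_; _≗_; refl; sym; trans; cong; cong₂; subst; subst₂)

-- Counting Boolean predicates on Fin n

infix 4 _⊆ᵇ_

_⊆ᵇ_ : ∀ {n} → (Fin n → Bool) → (Fin n → Bool) → Set
P ⊆ᵇ Q = ∀ i → P i ≡ true → Q i ≡ true

indicator : Bool → ℕ
indicator true  = 1
indicator false = 0

count : ∀ {n} → (Fin n → Bool) → ℕ
count {zero}  P = 0
count {suc n} P = indicator (P zero) + count (P ∘ suc)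

count-cong : ∀ {n} {P Q : Fin n → Bool} → P ≗ Q → count P ≡ count Q
count-cong {zero}  P≗Q = refl
count-cong {suc n} P≗Q = cong₂ _+_ (cong indicator (P≗Q zero)) (count-cong (P≗Q ∘ suc))

indicator-mono : ∀ {a b} → (a ≡ true → b ≡ true) → indicator a ≤ indicator b
indicator-mono {false} _   = z≤n
indicator-mono {true}  a⇒b rewrite a⇒b refl = ≤-refl

indicator≤1 : ∀ b → indicator b ≤ 1
indicator≤1 true  = ≤-refl
indicator≤1 false = z≤n

count-mono : ∀ {n} {P Q : Fin n → Bool} → P ⊆ᵇ Q → count P ≤ count Q
count-mono {zero}  P⊆Q = z≤n
count-mono {suc n} P⊆Q = +-mono-≤ (indicator-mono (P⊆Q zero)) (count-mono (P⊆Q ∘ suc))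

count-mono-< : ∀ {n} {P Q : Fin n → Bool} (v : Fin n) → P v ≡ false → Q v ≡ true →
               P ⊆ᵇ Q → count P < count Q
count-mono-< {suc n} zero    Pv Qv P⊆Q rewrite Pv | Qv = s≤s (count-mono (P⊆Q ∘ suc))
count-mono-< {suc n} (suc v) Pv Qv P⊆Q =
  +-mono-≤-< (indicator-mono (P⊆Q zero)) (count-mono-< v Pv Qv (P⊆Q ∘ suc))

count-empty : ∀ {n} {P : Fin n → Bool} → (∀ i → P i ≡ false) → count P ≡ 0
count-empty {zero}  _ = refl
count-empty {suc n} P≡false rewrite P≡false zero = count-empty (P≡false ∘ suc)

count-pos : ∀ {n} {P : Fin n → Bool} (v : Fin n) → P v ≡ true → 0 < count P
count-pos {n} {P} v Pv = subst (_< count P) (count-empty {n} {λ _ → false} λ _ → refl)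
                           (count-mono-< {n} {λ _ → false} v refl Pv λ _ ())

count≤n : ∀ {n} (P : Fin n → Bool) → count P ≤ n
count≤n {zero}  P = z≤n
count≤n {suc n} P = +-mono-≤ (indicator≤1 (P zero)) (count≤n (P ∘ suc))

count-full : ∀ n → count {n} (λ _ → true) ≡ n
count-full zero    = refl
count-full (suc n) = cong suc (count-full n)

-- Uses does, not ⌊_⌋: ⌊ suc w ≟ suc x ⌋ does not reduce to ⌊ w ≟ x ⌋, while does does.
⁅_⁆ᵇ : ∀ {n} → Fin n → Fin n → Bool
⁅ x ⁆ᵇ w = does (w ≟ x)

⁅⁆ᵇ-sound : ∀ {n} {x : Fin n} w → ⁅ x ⁆ᵇ w ≡ true → w ≡ x
⁅⁆ᵇ-sound {x = x} w w∈ with w ≟ x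
... | yes w≡x = w≡x

count-singleton : ∀ {n} (x : Fin n) → count ⁅ x ⁆ᵇ ≡ 1
count-singleton {suc n} zero    = cong suc (count-empty {n} λ _ → refl)
count-singleton {suc n} (suc x) = count-singleton x

count-≤1 : ∀ {n} {P : Fin n → Bool} (x : Fin n) → (∀ w → P w ≡ true → w ≡ x) → count P ≤ 1
count-≤1 {P = P} x P⊆x = ≤-trans (count-mono P⊆⁅x⁆) (≤-reflexive (count-singleton x))
  where
    P⊆⁅x⁆ : P ⊆ᵇ ⁅ x ⁆ᵇ
    P⊆⁅x⁆ w Pw with w ≟ x
    ... | yes _  = refl
    ... | no w≢x = contradiction (P⊆x w Pw) w≢x

insert : ∀ {n} → Fin n → (Fin n → Bool) → Fin n → Bool
insert x P w = P w ∨ ⁅ x ⁆ᵇ w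

insert-self : ∀ {n} (x : Fin n) P → insert x P x ≡ true
insert-self x P = trans (cong (P x ∨_) (dec-true (x ≟ x) refl)) (∨-zeroʳ (P x))

⊆ᵇ-insert : ∀ {n} (x : Fin n) P → P ⊆ᵇ insert x P
⊆ᵇ-insert x P w Pw = cong (_∨ ⁅ x ⁆ᵇ w) Pw

insert⁻ : ∀ {n} {x : Fin n} P w → insert x P w ≡ true → w ≡ x ⊎ P w ≡ true
insert⁻ {x = x} P w w∈ with w ≟ x
... | yes w≡x = inj₁ w≡x
... | no _    = inj₂ (trans (sym (∨-identityʳ (P w))) w∈)

∧-≡false : ∀ {a b} → (a ≡ true → b ≡ false) → a ∧ b ≡ false
∧-≡false {false} _    = refl
∧-≡false {true}  a⇒¬b = a⇒¬b refl

-- Sums over Fin n and counting on Fin (n * k)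

sum-const : ∀ n c → sum {n} (λ _ → c) ≡ n * c
sum-const zero    c = refl
sum-const (suc n) c = cong (c +_) (sum-const n c)

sum-zero : ∀ {n} {f : Fin n → ℕ} → (∀ i → f i ≡ 0) → sum f ≡ 0
sum-zero {n} f≡0 = trans (sum-cong-≗ f≡0) (sum-replicate-zero n)

term≤sum : ∀ {n} (f : Fin n → ℕ) i → f i ≤ sum f
term≤sum f zero    = m≤m+n _ _
term≤sum f (suc i) = ≤-trans (term≤sum (f ∘ suc) i) (m≤n+m _ _)

sum-≤ : ∀ {n} {f : Fin n → ℕ} {c} → (∀ i → f i ≤ c) → sum f ≤ n * c
sum-≤ {zero}  f≤c = z≤n
sum-≤ {suc n} f≤c = +-mono-≤ (f≤c zero) (sum-≤ (f≤c ∘ suc))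

pigeonhole : ∀ {n} (f : Fin n → ℕ) {c} → n * c < sum f → ∃ λ i → c < f i
pigeonhole f {c} nc<sum with any? (λ i → c <? f i)
... | yes found = found
... | no none   = contradiction (sum-≤ λ i → ≮⇒≥ λ c<fi → none (i , c<fi)) (<⇒≱ nc<sum)

count-↑ : ∀ a b (P : Fin (a + b) → Bool) →
          count P ≡ count (λ i → P (i ↑ˡ b)) + count (λ j → P (a ↑ʳ j))
count-↑ zero    b P = refl
count-↑ (suc a) b P = trans (cong (indicator (P zero) +_) (count-↑ a b (P ∘ suc)))
                            (sym (+-assoc (indicator (P zero)) _ _))

count-combine : ∀ n k (P : Fin (n * k) → Bool) →
                count P ≡ sum {n} (λ i → count (λ j → P (combine i j)))
count-combine zero    k P = refl
count-combine (suc n) k P = trans (count-↑ k (n * k) P)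
  (cong (count (λ j → P (j ↑ˡ n * k)) +_) (count-combine n k (λ i → P (k ↑ʳ i))))

block : ∀ {n k} → (Fin (n * k) → Bool) → Fin n → Fin k → Bool
block P i j = P (combine i j)

fromBlocks : ∀ {n k} → (Fin n → Fin k → Bool) → Fin (n * k) → Bool
fromBlocks {n} {k} B w = uncurry B (remQuot {n} k w)

block-fromBlocks : ∀ {n k} (B : Fin n → Fin k → Bool) i j → block (fromBlocks B) i j ≡ B i j
block-fromBlocks {n} {k} B i j = cong (uncurry B) (remQuot-combine {n} {k} i j)

count-fromBlocks : ∀ {n k} (B : Fin n → Fin k → Bool) → count (fromBlocks B) ≡ sum (λ i → count (B i))
count-fromBlocks {n} {k} B =
  trans (count-combine n k (fromBlocks B)) (sum-cong-≗ λ i → count-cong (block-fromBlocks B i))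

-- Extrema of lists

maxList-upper : ∀ {xs : List ℕ} {x} → x ∈ xs → x ≤ maxList xs
maxList-upper {xs} =
  All.lookup (foldr-forcesᵇ (λ x y le → m⊔n≤o⇒m≤o x y le , m⊔n≤o⇒n≤o x y le) 0 xs ≤-refl)

maxList-least : ∀ {xs : List ℕ} {d} → All (_≤ d) xs → maxList xs ≤ d
maxList-least = foldr-preservesᵇ ⊔-lub z≤n

maxList-sel : ∀ (xs : List ℕ) → maxList xs ≡ 0 ⊎ maxList xs ∈ xs
maxList-sel = foldr-selective ⊔-sel 0

minList-lower : ∀ {xs : List ℕ} {y} → y ∈ xs → minList xs ≤ y
minList-lower {x ∷ xs} (here refl) = foldr-preservesʳ {P = _≤ x} (λ z → m≤n⇒o⊓m≤n z) ≤-refl xs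
minList-lower {x ∷ xs} (there y∈xs) =
  All.lookup (foldr-forcesᵇ (λ a b le → m≤n⊓o⇒m≤n a b le , m≤n⊓o⇒m≤o a b le) x xs ≤-refl) y∈xs

minList-sel : ∀ x (xs : List ℕ) → minList (x ∷ xs) ∈ x ∷ xs
minList-sel x xs with foldr-selective ⊓-sel x xs
... | inj₁ ≡x  = here ≡x
... | inj₂ ∈xs = there ∈xs

minList-cong : ∀ (xs ys : List ℕ) →
  (∀ {x} → x ∈ xs → ∃ λ y → y ∈ ys × y ≤ x) →
  (∀ {y} → y ∈ ys → ∃ λ x → x ∈ xs × x ≤ y) → minList xs ≡ minList ys
minList-cong []       []       _     _     = refl
minList-cong []       (y ∷ ys) _     ys≽xs with ys≽xs (here refl)
... | _ , () , _
minList-cong (x ∷ xs) []       xs≽ys _     with xs≽ys (here refl)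
... | _ , () , _
minList-cong (x ∷ xs) (y ∷ ys) xs≽ys ys≽xs =
  ≤-antisym (below ys≽xs (minList-sel y ys)) (below xs≽ys (minList-sel x xs))
  where
    below : ∀ {us vs : List ℕ} {v} → (∀ {v} → v ∈ vs → ∃ λ u → u ∈ us × u ≤ v) →
            v ∈ vs → minList us ≤ v
    below us≼vs v∈vs with us≼vs v∈vs
    ... | u , u∈us , u≤v = ≤-trans (minList-lower u∈us) u≤v

-- α, Δ and σ for vertex sets given as predicates

Independent : ∀ {n} → Adj n → (Fin n → Bool) → Set
Independent A P = ∀ v w → P v ≡ true → P w ≡ true → A v w ≡ false

degree : ∀ {n} → Adj n → (Fin n → Bool) → Fin n → ℕ
degree A P v = count (λ w → P w ∧ A v w)

maxDegree : ∀ {n} → Adj n → (Fin n → Bool) → ℕ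
maxDegree A P = maxDegInduced A (tabulate P)

Admissible : ∀ {n} → Adj n → (Fin n → Bool) → Set
Admissible A P = indepNumber A < count P

count-lookup : ∀ {n} (S : Subset n) → ∣ S ∣ ≡ count (lookup S)
count-lookup []          = refl
count-lookup (true ∷ S)  = cong suc (count-lookup S)
count-lookup (false ∷ S) = count-lookup S

count-tabulate : ∀ {n} (P : Fin n → Bool) → ∣ tabulate P ∣ ≡ count P
count-tabulate P = trans (count-lookup (tabulate P)) (count-cong (lookup∘tabulate P))

length-filter-tabulate : ∀ {A : Set} {n} (p : A → Bool) (f : Fin n → A) →
  length (filter (λ x → p x Bool.≟ true) (List.tabulate f)) ≡ count (p ∘ f)
length-filter-tabulate {n = zero}  p f = refl
length-filter-tabulate {n = suc n} p f with p (f zero)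
... | true  = cong suc (length-filter-tabulate p (f ∘ suc))
... | false = length-filter-tabulate p (f ∘ suc)

degIn-tabulate : ∀ {n} (A : Adj n) P v → degIn A (tabulate P) v ≡ degree A P v
degIn-tabulate A P v = trans (length-filter-tabulate (λ w → lookup (tabulate P) w ∧ A v w) id)
                             (count-cong λ w → cong (_∧ A v w) (lookup∘tabulate P w))

∈-allSubsets : ∀ {n} (S : Subset n) → S ∈ allSubsets n
∈-allSubsets []                  = here refl
∈-allSubsets (true ∷ S)          = ∈-++⁺ˡ (∈-map⁺ (true ∷_) (∈-allSubsets S))
∈-allSubsets {suc n} (false ∷ S) =
  ∈-++⁺ʳ (map (true ∷_) (allSubsets n)) (∈-map⁺ (false ∷_) (∈-allSubsets S))

allB-sound : ∀ {A : Set} (p : A → Bool) xs → allB p xs ≡ true → ∀ {x} → x ∈ xs → p x ≡ true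
allB-sound p (y ∷ xs) all≡true x∈ with p y in py | x∈
... | true | here refl   = py
... | true | there x∈xs = allB-sound p xs all≡true x∈xs

allB-complete : ∀ {A : Set} (p : A → Bool) xs → (∀ x → p x ≡ true) → allB p xs ≡ true
allB-complete p []       _      = refl
allB-complete p (x ∷ xs) p≡true rewrite p≡true x = allB-complete p xs p≡true

isIndependent-sound : ∀ {n} (A : Adj n) S → isIndependent A S ≡ true → Independent A (lookup S)
isIndependent-sound {n} A S indep v w Sv Sw
  with allB-sound _ (allFin n) (allB-sound _ (allFin n) indep (∈-allFin v)) (∈-allFin w)
... | nonadjacent rewrite Sv | Sw = trans (sym (not-involutive (A v w))) (cong not nonadjacent)

isIndependent-complete : ∀ {n} (A : Adj n) S → Independent A (lookup S) → isIndependent A S ≡ true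
isIndependent-complete {n} A S indep =
  allB-complete _ (allFin n) λ v → allB-complete _ (allFin n) λ w → nonadjacent v w
  where
    nonadjacent : ∀ v w → not (lookup S v ∧ lookup S w ∧ A v w) ≡ true
    nonadjacent v w with lookup S v in Sv | lookup S w in Sw
    ... | false | _     = refl
    ... | true  | false = refl
    ... | true  | true  rewrite indep v w Sv Sw = refl

indepNumber-upper : ∀ {n} (A : Adj n) {P} → Independent A P → count P ≤ indepNumber A
indepNumber-upper {n} A {P} indep = begin
  count P          ≡⟨ count-tabulate P ⟨
  ∣ tabulate P ∣   ≤⟨ maxList-upper (∈-map⁺ ∣_∣ (∈-filter⁺ (λ S → isIndependent A S Bool.≟ true)
                                       (∈-allSubsets (tabulate P)) tabulate-independent)) ⟩
  indepNumber A    ∎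
  where
    open ≤-Reasoning
    tabulate-independent : isIndependent A (tabulate P) ≡ true
    tabulate-independent = isIndependent-complete A (tabulate P) λ v w Pv Pw →
      indep v w (trans (sym (lookup∘tabulate P v)) Pv) (trans (sym (lookup∘tabulate P w)) Pw)

indepNumber-attained : ∀ {n} (A : Adj n) → ∃ λ P → Independent A P × count P ≡ indepNumber A
indepNumber-attained {n} A
  with maxList-sel (map ∣_∣ (filter (λ S → isIndependent A S Bool.≟ true) (allSubsets n)))
... | inj₁ α≡0 = (λ _ → false) , (λ _ _ ()) , trans (count-empty {n} λ _ → refl) (sym α≡0)
... | inj₂ α∈ with ∈-map⁻ ∣_∣ α∈
...   | S , S∈ , α≡∣S∣ =
  lookup S ,
  isIndependent-sound A S (proj₂ (∈-filter⁻ _ {xs = allSubsets n} S∈)) ,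
  trans (sym (count-lookup S)) (sym α≡∣S∣)

maxDegree-lower : ∀ {n} (A : Adj n) P {v} → P v ≡ true → degree A P v ≤ maxDegree A P
maxDegree-lower A P {v} Pv = subst (_≤ maxDegree A P) vertex-term
  (maxList-upper (∈-map⁺ (λ v → if lookup (tabulate P) v then degIn A (tabulate P) v else 0) (∈-allFin v)))
  where
    vertex-term : (if lookup (tabulate P) v then degIn A (tabulate P) v else 0) ≡ degree A P v
    vertex-term rewrite lookup∘tabulate P v | Pv = degIn-tabulate A P v

maxDegree-least : ∀ {n} (A : Adj n) P {d} → (∀ v → P v ≡ true → degree A P v ≤ d) → maxDegree A P ≤ d
maxDegree-least {n} A P {d} deg≤d = maxList-least (All.tabulate vertex-term≤d)
  where
    vertex-term≤d : ∀ {x} →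
      x ∈ map (λ v → if lookup (tabulate P) v then degIn A (tabulate P) v else 0) (allFin n) → x ≤ d
    vertex-term≤d x∈ with ∈-map⁻ _ x∈
    ... | v , _ , refl rewrite lookup∘tabulate P v with P v in Pv
    ...   | true  = ≤-trans (≤-reflexive (degIn-tabulate A P v)) (deg≤d v Pv)
    ...   | false = z≤n

maxDegree-least-combine : ∀ {n k} (A : Adj (n * k)) P {d} →
  (∀ i j → block P i j ≡ true → degree A P (combine i j) ≤ d) → maxDegree A P ≤ d
maxDegree-least-combine {n} {k} A P deg≤d = maxDegree-least A P λ v Pv →
  subst (λ w → P w ≡ true → degree A P w ≤ _) (combine-remQuot {n} k v)
        (deg≤d (proj₁ (remQuot {n} k v)) (proj₂ (remQuot {n} k v))) Pv

infix 4 _≼σ_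

-- If B ≼σ A then σ B ≤ σ A.
_≼σ_ : ∀ {n n'} → Adj n → Adj n' → Set
_≼σ_ {n} B A = ∀ P → Admissible A P →
  ∃ λ (Q : Fin n → Bool) → Admissible B Q × maxDegree B Q ≤ maxDegree A P

σ-candidates : ∀ {n} → Adj n → List ℕ
σ-candidates {n} A =
  map (maxDegInduced A) (filter (λ S → (indepNumber A <ᵇ ∣ S ∣) Bool.≟ true) (allSubsets n))

∈-σ-candidates⁻ : ∀ {n} (A : Adj n) {x} → x ∈ σ-candidates A →
                  ∃ λ P → Admissible A P × maxDegree A P ≡ x
∈-σ-candidates⁻ {n} A x∈ with ∈-map⁻ (maxDegInduced A) x∈
... | S , S∈ , refl =
  lookup S ,
  subst (indepNumber A <_) (count-lookup S)
    (<ᵇ⇒< _ _ (Equivalence.from T-≡ (proj₂ (∈-filter⁻ _ {xs = allSubsets n} S∈)))) ,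
  cong (maxDegInduced A) (tabulate∘lookup S)

∈-σ-candidates⁺ : ∀ {n} (A : Adj n) {P} → Admissible A P → maxDegree A P ∈ σ-candidates A
∈-σ-candidates⁺ A {P} adm = ∈-map⁺ (maxDegInduced A) (∈-filter⁺ _ (∈-allSubsets (tabulate P))
  (Equivalence.to T-≡ (<⇒<ᵇ (subst (indepNumber A <_) (sym (count-tabulate P)) adm))))

σ-candidates-≼ : ∀ {n n'} (B : Adj n) (A : Adj n') → B ≼σ A →
  ∀ {x} → x ∈ σ-candidates A → ∃ λ y → y ∈ σ-candidates B × y ≤ x
σ-candidates-≼ B A B≼A x∈ with ∈-σ-candidates⁻ A x∈
... | P , adm , refl with B≼A P adm
...   | Q , admQ , Q≤P = maxDegree B Q , ∈-σ-candidates⁺ B admQ , Q≤P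

sigma-cong : ∀ {n n'} (A : Adj n) (B : Adj n') → A ≼σ B → B ≼σ A → sigma A ≡ sigma B
sigma-cong A B A≼B B≼A = minList-cong _ _ (σ-candidates-≼ B A B≼A) (σ-candidates-≼ A B A≼B)

sigma-unique : ∀ {n} (A : Adj n) {d} → (∀ P → Admissible A P → d ≤ maxDegree A P) →
  (∃ λ P → Admissible A P × maxDegree A P ≤ d) → sigma A ≡ d
sigma-unique A {d} lower (P₀ , adm₀ , P₀≤d) =
  minList-cong (σ-candidates A) (d ∷ []) bounded attained
  where
    bounded : ∀ {x} → x ∈ σ-candidates A → ∃ λ y → y ∈ d ∷ [] × y ≤ x
    bounded x∈ with ∈-σ-candidates⁻ A x∈
    ... | P , adm , refl = d , here refl , lower P adm
    attained : ∀ {y} → y ∈ d ∷ [] → ∃ λ x → x ∈ σ-candidates A × x ≤ y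
    attained (here refl) = maxDegree A P₀ , ∈-σ-candidates⁺ A adm₀ , P₀≤d

⁅⁆ᵇ-independent : ∀ {n} (X : SimpleGraph n) x → Independent (adj X) ⁅ x ⁆ᵇ
⁅⁆ᵇ-independent X x v w v∈ w∈ with ⁅⁆ᵇ-sound v v∈ | ⁅⁆ᵇ-sound w w∈
... | refl | refl = irrefl X x

indepNumber-pos : ∀ {n} (X : SimpleGraph (suc n)) → 0 < indepNumber (adj X)
indepNumber-pos {n} X = ≤-trans (count-pos {suc n} {⁅ zero ⁆ᵇ} zero (dec-true (zero {n} ≟ zero) refl))
                                (indepNumber-upper (adj X) (⁅⁆ᵇ-independent X zero))

indepNumber≤n : ∀ {n} (A : Adj n) → indepNumber A ≤ n
indepNumber≤n A with indepNumber-attained A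
... | P , _ , P≡α = subst (_≤ _) P≡α (count≤n P)

edgeless-nonadjacent : ∀ {n} (A : Adj n) → ¬ HasEdge A → ∀ v w → A v w ≡ false
edgeless-nonadjacent A noEdge v w with A v w in vw
... | false = refl
... | true  = contradiction (v , w , vw) noEdge

indepNumber-edgeless : ∀ {n} (A : Adj n) → ¬ HasEdge A → indepNumber A ≡ n
indepNumber-edgeless {n} A noEdge = ≤-antisym (indepNumber≤n A)
  (subst (_≤ indepNumber A) (count-full n)
         (indepNumber-upper A λ v w _ _ → edgeless-nonadjacent A noEdge v w))

independent-not-full : ∀ {n} {A : Adj n} {I} → HasEdge A → Independent A I → ∃ λ x → I x ≡ false
independent-not-full {n} {I = I} (u , v , uv) indep = map₂ ¬-not
  (¬∀⟶∃¬ n _ (λ x → I x Bool.≟ true) λ full →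
     contradiction (trans (sym uv) (indep u v (full u) (full v))) λ ())

maxDegree-insert : ∀ {n} (X : SimpleGraph n) {I} x → Independent (adj X) I →
  maxDegree (adj X) (insert x I) ≤ count I ⊔ 1
maxDegree-insert X {I} x indep = maxDegree-least (adj X) (insert x I) degree≤
  where
    degree≤ : ∀ y → insert x I y ≡ true → degree (adj X) (insert x I) y ≤ count I ⊔ 1
    degree≤ y y∈ with insert⁻ I y y∈
    ... | inj₁ refl = m≤n⇒m≤n⊔o 1 (count-mono neighbour∈I)
      where
        neighbour∈I : (λ w → insert x I w ∧ adj X x w) ⊆ᵇ I
        neighbour∈I w w∼x with insert⁻ I w (∧-conicalˡ _ _ w∼x)
        ... | inj₁ refl = contradiction (trans (sym (∧-conicalʳ _ _ w∼x)) (irrefl X x)) λ ()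
        ... | inj₂ Iw   = Iw
    ... | inj₂ Iy = m≤n⇒m≤o⊔n (count I) (count-≤1 x neighbour≡x)
      where
        neighbour≡x : ∀ w → (insert x I w ∧ adj X y w) ≡ true → w ≡ x
        neighbour≡x w w∼y with insert⁻ I w (∧-conicalˡ _ _ w∼y)
        ... | inj₁ w≡x = w≡x
        ... | inj₂ Iw  = contradiction (trans (sym (∧-conicalʳ _ _ w∼y)) (indep y w Iy Iw)) λ ()

admissible-maxDegree≤indepNumber : ∀ {n} (X : SimpleGraph (suc n)) → HasEdge (adj X) →
  ∃ λ Q → Admissible (adj X) Q × maxDegree (adj X) Q ≤ indepNumber (adj X)
admissible-maxDegree≤indepNumber X edge with indepNumber-attained (adj X)
... | I , indep , I≡α with independent-not-full edge indep
...   | x , x∉I = insert x I , admissible , maxDegree≤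
  where
    admissible : Admissible (adj X) (insert x I)
    admissible = subst (_< count (insert x I)) I≡α
                       (count-mono-< x x∉I (insert-self x I) (⊆ᵇ-insert x I))
    maxDegree≤ : maxDegree (adj X) (insert x I) ≤ indepNumber (adj X)
    maxDegree≤ = begin
      maxDegree (adj X) (insert x I)   ≤⟨ maxDegree-insert X x indep ⟩
      count I ⊔ 1                      ≡⟨ cong (_⊔ 1) I≡α ⟩
      indepNumber (adj X) ⊔ 1          ≡⟨ m≥n⇒m⊔n≡m (indepNumber-pos X) ⟩
      indepNumber (adj X)              ∎
      where open ≤-Reasoning

-- K₁ ∨ H

degree-join-apex : ∀ {m} (h : Adj m) P → degree (join1 h) P zero ≡ count (P ∘ suc)
degree-join-apex h P rewrite ∧-zeroʳ (P zero) = count-cong λ i → ∧-identityʳ (P (suc i))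

degree≤degree-join : ∀ {m} (h : Adj m) P v → degree h (P ∘ suc) v ≤ degree (join1 h) P (suc v)
degree≤degree-join h P v = m≤n+m _ _

maxDegree-join-lift : ∀ {m} (h : Adj m) Q → maxDegree (join1 h) (false ∷ᶠ Q) ≤ maxDegree h Q
maxDegree-join-lift h Q = maxDegree-least (join1 h) (false ∷ᶠ Q) λ where
  (suc v) Qv → maxDegree-lower h Q Qv

Independent-join-lift : ∀ {m} (h : Adj m) {Q} → Independent h Q → Independent (join1 h) (false ∷ᶠ Q)
Independent-join-lift h indep (suc v) (suc w) Qv Qw = indep v w Qv Qw

Independent-join-restrict : ∀ {m} (h : Adj m) {P} → Independent (join1 h) P → Independent h (P ∘ suc)
Independent-join-restrict h indep v w = indep (suc v) (suc w)

Independent-join-apex : ∀ {m} (h : Adj m) {P} → Independent (join1 h) P → P zero ≡ true →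
                        ∀ i → P (suc i) ≡ false
Independent-join-apex h {P} indep Pz i with P (suc i) in Pi
... | false = refl
... | true  = contradiction (indep zero (suc i) Pz Pi) λ ()

indepNumber-join : ∀ {m} (H : SimpleGraph (suc m)) → indepNumber (join1 (adj H)) ≡ indepNumber (adj H)
indepNumber-join H = ≤-antisym α-join≤α α≤α-join
  where
    h = adj H
    α-join≤α : indepNumber (join1 h) ≤ indepNumber h
    α-join≤α with indepNumber-attained (join1 h)
    ... | P , indep , P≡α with P zero in Pz
    ...   | false = subst (_≤ indepNumber h) P≡α (indepNumber-upper h (Independent-join-restrict h indep))
    ...   | true  = subst (_≤ indepNumber h)
                          (trans (cong suc (sym (count-empty (Independent-join-apex h indep Pz)))) P≡α)
                          (indepNumber-pos H)
    α≤α-join : indepNumber h ≤ indepNumber (join1 h)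
    α≤α-join with indepNumber-attained h
    ... | I , indep , I≡α = subst (_≤ indepNumber (join1 h)) I≡α
                              (indepNumber-upper (join1 h) (Independent-join-lift h indep))

module _ {m} (H : SimpleGraph (suc m)) where
  private
    h = adj H
    J = join1 h

  Admissible-join-lift : ∀ {Q} → Admissible h Q → Admissible J (false ∷ᶠ Q)
  Admissible-join-lift = subst (_< _) (sym (indepNumber-join H))

  Admissible-join-without-apex : ∀ {P} → Admissible J P → P zero ≡ false → Admissible h (P ∘ suc)
  Admissible-join-without-apex {P} adm Pz rewrite Pz =
    subst (_< count (P ∘ suc)) (indepNumber-join H) adm

  indepNumber≤maxDegree-with-apex : ∀ {P} → Admissible J P → P zero ≡ true →
                                    indepNumber h ≤ maxDegree J P
  indepNumber≤maxDegree-with-apex {P} adm Pz = begin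
    indepNumber h     ≤⟨ ≤-pred (subst₂ _<_ (indepNumber-join H)
                                   (cong (λ b → indicator b + count (P ∘ suc)) Pz) adm) ⟩
    count (P ∘ suc)   ≡⟨ degree-join-apex h P ⟨
    degree J P zero   ≤⟨ maxDegree-lower J P Pz ⟩
    maxDegree J P     ∎
    where open ≤-Reasoning

  join-≼σ-graph : J ≼σ h
  join-≼σ-graph Q adm = false ∷ᶠ Q , Admissible-join-lift {Q} adm , maxDegree-join-lift h Q

  graph-≼σ-join : HasEdge h → h ≼σ J
  graph-≼σ-join edge P adm with P zero Bool.≟ true
  ... | no apex∉P =
    P ∘ suc , Admissible-join-without-apex {P} adm (¬-not apex∉P) ,
    maxDegree-least h (P ∘ suc) λ w Pw → ≤-trans (degree≤degree-join h P w) (maxDegree-lower J P Pw)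
  ... | yes Pz with admissible-maxDegree≤indepNumber H edge
  ...   | Q , admQ , Q≤α = Q , admQ , ≤-trans Q≤α (indepNumber≤maxDegree-with-apex {P} adm Pz)

  sigma-join-edgeless : ¬ HasEdge h → sigma J ≡ suc m
  sigma-join-edgeless noEdge = sigma-unique J lower (full , full-admissible , full-maxDegree)
    where
      α≡m : indepNumber h ≡ suc m
      α≡m = indepNumber-edgeless h noEdge

      lower : ∀ P → Admissible J P → suc m ≤ maxDegree J P
      lower P adm with P zero Bool.≟ true
      ... | no apex∉P = contradiction
        (subst (_< count (P ∘ suc)) α≡m (Admissible-join-without-apex {P} adm (¬-not apex∉P)))
        (≤⇒≯ (count≤n (P ∘ suc)))
      ... | yes Pz = subst (_≤ maxDegree J P) α≡m (indepNumber≤maxDegree-with-apex {P} adm Pz)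

      full : Fin (suc (suc m)) → Bool
      full _ = true

      full-admissible : Admissible J full
      full-admissible = subst₂ _<_ (sym (trans (indepNumber-join H) α≡m)) (sym (count-full (suc (suc m))))
                               (n<1+n (suc m))

      full-maxDegree : maxDegree J full ≤ suc m
      full-maxDegree = maxDegree-least J full λ where
        zero    _ → ≤-reflexive (trans (degree-join-apex h full) (count-full (suc m)))
        (suc v) _ → s≤s (subst (_≤ m) (sym (count-empty {suc m} (edgeless-nonadjacent h noEdge v))) z≤n)

-- G ⊙ H

⌊≟⌋-refl : ∀ {n} (i : Fin n) → ⌊ i ≟ i ⌋ ≡ true
⌊≟⌋-refl i = trans (isYes≗does (i ≟ i)) (dec-true (i ≟ i) refl)

⌊≟⌋-≢ : ∀ {n} {i i' : Fin n} → i ≢ i' → ⌊ i ≟ i' ⌋ ≡ false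
⌊≟⌋-≢ {i = i} {i'} i≢i' = trans (isYes≗does (i ≟ i')) (dec-false (i ≟ i') i≢i')

module _ {n m} (G : SimpleGraph n) (H : SimpleGraph (suc m)) where
  private
    g = adj G
    h = adj H
    J = join1 h
    C = corona g h
    k : ℕ
    k = suc (suc m)

  corona-combine : ∀ i j i' j' → C (combine i j) (combine i' j') ≡ coronaPair g h (i , j) (i' , j')
  corona-combine i j i' j' rewrite remQuot-combine {n} {k} i j | remQuot-combine {n} {k} i' j' = refl

  coronaPair-same-block : ∀ i j j' → coronaPair g h (i , j) (i , j') ≡ J j j'
  coronaPair-same-block i zero    zero     = irrefl G i
  coronaPair-same-block i zero    (suc j') = cong (_∧ true) (⌊≟⌋-refl i)
  coronaPair-same-block i (suc j) j'       = cong (_∧ J (suc j) j') (⌊≟⌋-refl i)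

  coronaPair-other-block : ∀ {i i'} j j' → i ≢ i' → (j ≢ zero ⊎ j' ≢ zero) →
                           coronaPair g h (i , j) (i' , j') ≡ false
  coronaPair-other-block zero    zero     _    (inj₁ j≢0)  = contradiction refl j≢0
  coronaPair-other-block zero    zero     _    (inj₂ j'≢0) = contradiction refl j'≢0
  coronaPair-other-block zero    (suc j') i≢i' _           = cong (_∧ true) (⌊≟⌋-≢ i≢i')
  coronaPair-other-block (suc j) j'       i≢i' _           = cong (_∧ J (suc j) j') (⌊≟⌋-≢ i≢i')

  degree-corona : ∀ P i j → degree C P (combine i j) ≡
    sum {n} (λ i' → count (λ j' → block P i' j' ∧ coronaPair g h (i , j) (i' , j')))
  degree-corona P i j = trans (count-combine n k _)
    (sum-cong-≗ λ i' → count-cong λ j' → cong (block P i' j' ∧_) (corona-combine i j i' j'))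

  degree-corona-fromBlocks : ∀ B i j → degree C (fromBlocks B) (combine i j) ≡
    sum {n} (λ i' → count (λ j' → B i' j' ∧ coronaPair g h (i , j) (i' , j')))
  degree-corona-fromBlocks B i j = trans (degree-corona (fromBlocks B) i j)
    (sum-cong-≗ λ i' → count-cong λ j' →
       cong (_∧ coronaPair g h (i , j) (i' , j')) (block-fromBlocks B i' j'))

  degree-block≤degree-corona : ∀ P i j → degree J (block P i) j ≤ degree C P (combine i j)
  degree-block≤degree-corona P i j = begin
    degree J (block P i) j
      ≡⟨ count-cong (λ j' → cong (block P i j' ∧_) (coronaPair-same-block i j j')) ⟨
    count (λ j' → block P i j' ∧ coronaPair g h (i , j) (i , j'))
      ≤⟨ term≤sum _ i ⟩
    sum (λ i' → count (λ j' → block P i' j' ∧ coronaPair g h (i , j) (i' , j')))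
      ≡⟨ degree-corona P i j ⟨
    degree C P (combine i j)
      ∎
    where open ≤-Reasoning

  Independent-block : ∀ {P} → Independent C P → ∀ i → Independent J (block P i)
  Independent-block indep i j j' Pj Pj' =
    trans (sym (coronaPair-same-block i j j')) (trans (sym (corona-combine i j i j')) (indep _ _ Pj Pj'))

  apexFree-maxIndependent : ∃ λ I → Independent J I × I zero ≡ false × count I ≡ indepNumber J
  apexFree-maxIndependent with indepNumber-attained h
  ... | I , indep , I≡α =
    false ∷ᶠ I , Independent-join-lift h indep , refl , trans I≡α (sym (indepNumber-join H))

  coronaPair-apexFree : ∀ {I} → Independent J I → I zero ≡ false →
    ∀ p p' → I (proj₂ p) ≡ true → I (proj₂ p') ≡ true → coronaPair g h p p' ≡ false
  coronaPair-apexFree indep I0 (i , zero)  _         Ij _   = contradiction (trans (sym I0) Ij) λ ()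
  coronaPair-apexFree indep I0 (i , suc a) (i' , j') Ij Ij' =
    trans (cong (⌊ i ≟ i' ⌋ ∧_) (indep (suc a) j' Ij Ij')) (∧-zeroʳ _)

  indepNumber-corona : indepNumber C ≡ n * indepNumber J
  indepNumber-corona = ≤-antisym α≤ ≤α
    where
      α≤ : indepNumber C ≤ n * indepNumber J
      α≤ with indepNumber-attained C
      ... | P , indep , P≡α = subst (_≤ n * indepNumber J) (trans (sym (count-combine n k P)) P≡α)
                                (sum-≤ λ i → indepNumber-upper J (Independent-block indep i))
      ≤α : n * indepNumber J ≤ indepNumber C
      ≤α with apexFree-maxIndependent
      ... | I , indep , I0 , I≡α = subst (_≤ indepNumber C)
        (trans (count-fromBlocks {n} (λ _ → I)) (trans (sum-const n (count I)) (cong (n *_) I≡α)))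
        (indepNumber-upper C λ v w → coronaPair-apexFree indep I0 (remQuot {n} k v) (remQuot {n} k w))

  join-≼σ-corona : J ≼σ C
  join-≼σ-corona P adm
    with pigeonhole (λ i → count (block P i)) (subst₂ _<_ indepNumber-corona (count-combine n k P) adm)
  ... | i , block-admissible =
    block P i , block-admissible ,
    maxDegree-least J (block P i) λ j Pj →
      ≤-trans (degree-block≤degree-corona P i j) (maxDegree-lower C P Pj)

module _ {n m} (G : SimpleGraph (suc n)) (H : SimpleGraph (suc m)) where
  private
    g = adj G
    h = adj H
    J = join1 h
    C = corona g h
    k : ℕ
    k = suc (suc m)

  corona-≼σ-join : C ≼σ J
  corona-≼σ-join T adm with apexFree-maxIndependent G H
  ... | I , indep , I0 , I≡α =
    fromBlocks B , admissible ,
    maxDegree-least-combine C (fromBlocks B) λ i j Bij →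
      ≤-trans (≤-reflexive (degree-corona-fromBlocks G H B i j))
              (degree≤ i j (trans (sym (block-fromBlocks B i j)) Bij))
    where
      B : Fin (suc n) → Fin k → Bool
      B zero    = T
      B (suc _) = I

      apexFree : ∀ {j} → I j ≡ true → j ≢ zero
      apexFree Ij refl = contradiction (trans (sym I0) Ij) λ ()

      admissible : Admissible C (fromBlocks B)
      admissible = begin-strict
        indepNumber C                       ≡⟨ indepNumber-corona G H ⟩
        indepNumber J + n * indepNumber J   <⟨ +-monoˡ-< _ adm ⟩
        count T + n * indepNumber J         ≡⟨ cong (count T +_) (trans (sum-const n (count I)) (cong (n *_) I≡α)) ⟨
        count T + sum {n} (λ _ → count I)   ≡⟨ count-fromBlocks B ⟨
        count (fromBlocks B)                ∎
        where open ≤-Reasoning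

      degree≤ : ∀ i j → B i j ≡ true →
                sum (λ i' → count (λ j' → B i' j' ∧ coronaPair g h (i , j) (i' , j'))) ≤ maxDegree J T
      degree≤ zero j Tj = begin
        count (λ j' → T j' ∧ coronaPair g h (zero , j) (zero , j'))
          + sum (λ i' → count (λ j' → I j' ∧ coronaPair g h (zero , j) (suc i' , j')))
          ≡⟨ cong₂ _+_ (count-cong λ j' → cong (T j' ∧_) (coronaPair-same-block G H zero j j'))
                       (sum-zero {n} λ i' → count-empty λ j' → ∧-≡false λ Ij' →
                          coronaPair-other-block G H {zero} {suc i'} j j' (λ ()) (inj₂ (apexFree Ij'))) ⟩
        degree J T j + 0   ≡⟨ +-identityʳ _ ⟩
        degree J T j       ≤⟨ maxDegree-lower J T Tj ⟩
        maxDegree J T      ∎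
        where open ≤-Reasoning
      degree≤ (suc i) j Ij =
        ≤-trans (≤-reflexive (sum-zero λ i' → count-empty λ j' → ∧-≡false (isolated i' j'))) z≤n
        where
          isolated : ∀ i' j' → B i' j' ≡ true → coronaPair g h (suc i , j) (i' , j') ≡ false
          isolated i' j' Bij' with i' ≟ suc i
          ... | yes refl = trans (coronaPair-same-block G H (suc i) j j') (indep j j' Ij Bij')
          ... | no i'≢i  = coronaPair-other-block G H j j' (i'≢i ∘ sym) (inj₁ (apexFree Ij))

corollary4p20 : ∀ {n m} (G : SimpleGraph n) (H : SimpleGraph m) → 1 ≤ n → 1 ≤ m →
    (sigma (corona (adj G) (adj H)) ≡ sigma (join1 (adj H)))
    × (HasEdge (adj H) → sigma (join1 (adj H)) ≡ sigma (adj H))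
    × (¬ HasEdge (adj H) → sigma (join1 (adj H)) ≡ m)
corollary4p20 G H (s≤s _) (s≤s _) =
  sigma-cong _ _ (corona-≼σ-join G H) (join-≼σ-corona G H) ,
  (λ edge → sigma-cong _ _ (join-≼σ-graph H) (graph-≼σ-join H edge)) ,
  sigma-join-edgeless H
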